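{- Let $T$ be a ranking function template, let $P=(\mathrm{stem},\mathrm{loop})$ be a lasso program over $K^n$, and let $(\psi_\ell)_{\ell\in L}$ be a finite family of invariants of $P$. If there is an assignment of values in $K$ to the variables of $T$ and of affine-linear functions to the function symbols of $T$ such that $$\forall x,x'\in K^n.\ \Big((x,x')\in\mathrm{loop}\wedge\bigwedge_{\ell\in L}\psi_\ell(x)\Big)\rightarrow T(x,x')$$ holds, then $P$ terminates.
   Context: $K$ is $\mathbb{Q}$ or a real closed field. A lasso program over $K^n$ is a pair $P=(\mathrm{stem},\mathrm{loop})$ with $\mathrm{stem}\subseteq K^n$ and $\mathrm{loop}\subseteq K^n\times K^n$; an execution is a finite or infinite sequence $\sigma_0\sigma_1\ldots$ of elements of $K^n$ with $\sigma_0\in\mathrm{stem}$ and $(\sigma_i,\sigma_{i+1})\in\mathrm{loop}$ for all $i$; a state is reachable iff it occurs in some execution; $P$ terminates iff it has no infinite execution. An invariant of $P$ is a formula (equivalently a subset of $K^n$) $\psi$ such that $\psi(\sigma)$ holds for every reachable state $\sigma$. A template is a quantifier-free formula $T(x,x')$ in $x,x'\in K^n$ that additionally contains a finite set $D$ of unknown scalars ("variables") and a finite set $F$ of affine-linear function symbols, each $f\in F$ standing for an unknown function $x\mapsto s_f^Tx+t_f$. $T$ is a ranking function template iff for every lasso program $Q=(\mathrm{stem}_Q,\mathrm{loop}_Q)$ over $K^n$: if there is an assignment of values in $K$ to the variables in $D$ and of affine-linear functions to the symbols in $F$ such that $\forall \sigma,\sigma'\in K^n.\ (\sigma,\sigma')\in\mathrm{loop}_Q\rightarrow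 T(\sigma,\sigma')$ holds, then $Q$ terminates. -}

module Defs where

open import Data.Nat using (ℕ; zero; suc)
open import Data.Fin using (Fin; zero; suc)
open import Data.Product using (Σ; _×_; _,_)
open import Data.Sum using (_⊎_)
open import Data.Empty using (⊥)
open import Data.Unit using (⊤)
open import Relation.Nullary using (¬_)
open import Relation.Binary.PropositionalEquality using (_≡_)

-- The scalar domain K, given by the signature of ordered rings
-- (ℚ and any real closed field are instances).  Only the operations
-- needed to interpret template formulas are required.
record Scalars : Set₁ where
  field
    K    : Set
    0K   : K
    1K   : K
    _+K_ : K → K → K
    _*K_ : K → K → K
    -K_  : K → K
    _≤K_ : K → K → Set
    _<K_ : K → K → Set

module _ (𝕂 : Scalars) where
  open Scalars 𝕂

  State : ℕ → Set
  State n = Fin n → K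

  sumK : ∀ {n} → (Fin n → K) → K
  sumK {zero}  v = 0K
  sumK {suc n} v = v zero +K sumK (λ i → v (suc i))

  record Affine (n : ℕ) : Set where
    constructor affine
    field
      s : Fin n → K
      t : K

  applyAffine : ∀ {n} → Affine n → State n → K
  applyAffine (affine s t) x = sumK (λ i → s i *K x i) +K t

  record Lasso (n : ℕ) : Set₁ where
    field
      stem : State n → Set
      loop : State n → State n → Set

  open Lasso

  record InfiniteExecution {n} (P : Lasso n) : Set where
    field
      seq     : ℕ → State n
      initial : stem P (seq 0)
      step    : ∀ i → loop P (seq i) (seq (suc i))

  -- finite execution σ₀ … σₘ (length m+1)
  record FiniteExecution {n} (P : Lasso n) : Set where
    field
      len     : ℕ
      seq     : Fin (suc len) → State n
      initial : stem P (seq zero)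
      step    : ∀ (i : Fin len) →
                loop P (seq (Data.Fin.inject₁ i)) (seq (suc i))

  Reachable : ∀ {n} → Lasso n → State n → Set
  Reachable P σ =
      Σ (FiniteExecution P) (λ e → Σ (Fin (suc (FiniteExecution.len e)))
          (λ i → FiniteExecution.seq e i ≡ σ))
    ⊎ Σ (InfiniteExecution P) (λ e → Σ ℕ (λ i → InfiniteExecution.seq e i ≡ σ))

  Terminates : ∀ {n} → Lasso n → Set
  Terminates P = ¬ InfiniteExecution P

  Invariant : ∀ {n} → Lasso n → (State n → Set) → Set
  Invariant P ψ = ∀ σ → Reachable P σ → ψ σ

-- Template syntax: quantifier-free formulas in x, x' ∈ K^n with
-- d unknown scalars and k affine-linear function symbols, each applied to x or x'.
data Term (n d k : ℕ) : Set where
  varx     : Fin n → Term n d k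
  varx'    : Fin n → Term n d k
  unk    : Fin d → Term n d k
  f[x]   : Fin k → Term n d k
  f[x']  : Fin k → Term n d k
  `0 `1  : Term n d k
  _⊕_ _⊗_ : Term n d k → Term n d k → Term n d k
  ⊖_     : Term n d k → Term n d k

data Template (n d k : ℕ) : Set where
  _≤ₜ_ _<ₜ_ _=ₜ_ : Term n d k → Term n d k → Template n d k
  ⊤ₜ ⊥ₜ          : Template n d k
  _∧ₜ_ _∨ₜ_      : Template n d k → Template n d k → Template n d k
  ¬ₜ_            : Template n d k → Template n d k

module _ (𝕂 : Scalars) where
  open Scalars 𝕂

  record Assignment (n d k : ℕ) : Set where
    field
      val : Fin d → K
      fun : Fin k → Affine 𝕂 n

  open Assignment

  evalTerm : ∀ {n d k} → Assignment n d k → State 𝕂 n → State 𝕂 n → Term n d k → K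
  evalTerm α x x' (varx i)    = x i
  evalTerm α x x' (varx' i)   = x' i
  evalTerm α x x' (unk j)   = val α j
  evalTerm α x x' (f[x] j)  = applyAffine 𝕂 (fun α j) x
  evalTerm α x x' (f[x'] j) = applyAffine 𝕂 (fun α j) x'
  evalTerm α x x' `0        = 0K
  evalTerm α x x' `1        = 1K
  evalTerm α x x' (a ⊕ b)   = evalTerm α x x' a +K evalTerm α x x' b
  evalTerm α x x' (a ⊗ b)   = evalTerm α x x' a *K evalTerm α x x' b
  evalTerm α x x' (⊖ a)     = -K evalTerm α x x' a

  ⟦_⟧ : ∀ {n d k} → Template n d k → Assignment n d k → State 𝕂 n → State 𝕂 n → Set
  ⟦ a ≤ₜ b ⟧ α x x' = evalTerm α x x' a ≤K evalTerm α x x' b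
  ⟦ a <ₜ b ⟧ α x x' = evalTerm α x x' a <K evalTerm α x x' b
  ⟦ a =ₜ b ⟧ α x x' = evalTerm α x x' a ≡ evalTerm α x x' b
  ⟦ ⊤ₜ ⟧ α x x'     = ⊤
  ⟦ ⊥ₜ ⟧ α x x'     = ⊥
  ⟦ φ ∧ₜ χ ⟧ α x x' = ⟦ φ ⟧ α x x' × ⟦ χ ⟧ α x x'
  ⟦ φ ∨ₜ χ ⟧ α x x' = ⟦ φ ⟧ α x x' ⊎ ⟦ χ ⟧ α x x'
  ⟦ ¬ₜ φ ⟧ α x x'   = ¬ ⟦ φ ⟧ α x x'

  IsRankingTemplate : ∀ {n d k} → Template n d k → Set₁
  IsRankingTemplate {n} {d} {k} T =
    ∀ (Q : Lasso 𝕂 n) →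
      Σ (Assignment n d k) (λ α → ∀ σ σ' → Lasso.loop Q σ σ' → ⟦ T ⟧ α σ σ') →
      Terminates 𝕂 Q

-- Let P be a lasso program and Q its restriction to reachable states:
-- Q has the stem of P, and a Q-step is a P-step that starts in a
-- reachable state of P.  Two facts about Q drive the proof.
--
--   * Every infinite execution of P is also one of Q, since each state
--     of an infinite execution is reachable (it occurs in that execution).
--     So if Q terminates, P terminates too.
--   * Every invariant holds at the source of each Q-step.  Hence, if the
--     template T is satisfied on every P-step whose source satisfies the
--     invariants ψ_ℓ, then T is satisfied on every Q-step.
--
-- Since T is a ranking function template, the second fact shows Q
-- terminates, and the first fact transfers termination to P.
module Submission where

open import Defs
open import Data.Nat using (ℕ)
open import Data.Fin using (Fin)
open import Data.Product using (Σ; _×_; _,_; proj₁)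
open import Data.Sum using (inj₂)
open import Relation.Binary.PropositionalEquality using (refl)

module _ (𝕂 : Scalars) {n : ℕ} where

  restrictToReachable : Lasso 𝕂 n → Lasso 𝕂 n
  restrictToReachable P = record
    { stem = Lasso.stem P
    ; loop = λ σ σ' → Lasso.loop P σ σ' × Reachable 𝕂 P σ
    }

  infinite-reachable : (P : Lasso 𝕂 n) (e : InfiniteExecution 𝕂 P) (i : ℕ) →
                       Reachable 𝕂 P (InfiniteExecution.seq e i)
  infinite-reachable P e i = inj₂ (e , i , refl)

  restrict-execution : (P : Lasso 𝕂 n) → InfiniteExecution 𝕂 P →
                       InfiniteExecution 𝕂 (restrictToReachable P)
  restrict-execution P e = record
    { seq     = InfiniteExecution.seq e
    ; initial = InfiniteExecution.initial e
    ; step    = λ i → InfiniteExecution.step e i , infinite-reachable P e i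
    }

  terminates-from-restriction : (P : Lasso 𝕂 n) →
    Terminates 𝕂 (restrictToReachable P) → Terminates 𝕂 P
  terminates-from-restriction P term e = term (restrict-execution P e)

  invariants-on-restricted-loop :
    (P : Lasso 𝕂 n) {L : ℕ} (ψ : Fin L → State 𝕂 n → Set) →
    (∀ ℓ → Invariant 𝕂 P (ψ ℓ)) →
    ∀ σ σ' → Lasso.loop (restrictToReachable P) σ σ' → ∀ ℓ → ψ ℓ σ
  invariants-on-restricted-loop P ψ inv σ σ' (_ , reach) ℓ = inv ℓ σ reach

lemma5p1 : (𝕂 : Scalars) {n d k : ℕ} (T : Template n d k) →
    IsRankingTemplate 𝕂 T →
    (P : Lasso 𝕂 n) (L : ℕ) (ψ : Fin L → State 𝕂 n → Set) →
    (∀ ℓ → Invariant 𝕂 P (ψ ℓ)) →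
    Σ (Assignment 𝕂 n d k) (λ α → ∀ x x' → Lasso.loop P x x' →
    (∀ ℓ → ψ ℓ x) → ⟦_⟧ 𝕂 T α x x') →
    Terminates 𝕂 P
lemma5p1 𝕂 T ranking P L ψ inv (α , T-holds) =
  terminates-from-restriction 𝕂 P (ranking (restrictToReachable 𝕂 P) (α , T-on-Q))
  where
  T-on-Q : ∀ σ σ' → Lasso.loop (restrictToReachable 𝕂 P) σ σ' → ⟦_⟧ 𝕂 T α σ σ'
  T-on-Q σ σ' q =
    T-holds σ σ' (proj₁ q) (invariants-on-restricted-loop 𝕂 P ψ inv σ σ' q)
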